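{- Let $a,b\in\mathbb{Z}[i]\setminus\{0\}$ have non-zero Gauss remainder $r$. If $\phi_{\mathbb{Z}[i]}(r)\geq\phi_{\mathbb{Z}[i]}(b)=n$ and $\Im(u_b b)\,\Im(u_r r)<0$, then $u_b b-u_r r\in\{(\ell_\infty(b)-\ell_\infty(r))\pm(m(b)+m(r))i\}$ and $u_b b+s(r)\,i\,u_r r\in\{(\ell_\infty(b)-m(r))\pm(m(b)-\ell_\infty(r))i\}$.
   Context: $\mathbb{Z}[i]$ has units $\pm1,\pm i$ and norm $\mathrm{Nm}(x+yi)=x^2+y^2$. A function $f:\mathbb{Z}[i]\setminus\{0\}\to W$ ($W$ a well-ordered set having $\mathbb{N}$ as an initial segment) is Euclidean if for all nonzero $a,b$ there exist $q,r$ with $a=qb+r$ and either $r=0$ or $f(r)<f(b)$. $\phi_{\mathbb{Z}[i]}$ is the minimal Euclidean function, the pointwise minimum of all Euclidean functions (equivalently, the minimal $n$ such that $z=\sum_{j=0}^n u_j(1+i)^j$ with $u_j\in\{0,\pm1,\pm i\}$, $u_n\ne0$). Gauss remainder: write $a\bar b/\mathrm{Nm}(b)=\alpha+\beta i$; let $\lfloor x\rceil=\lfloor x\rfloor$ if $0\le x-\lfloor x\rfloor\le1/2$ and $\lceil x\rceil$ otherwise; $q=\lfloor\alpha\rceil+\lfloor\beta\rceil i$ and $r=a-qb$. $\ell_\infty(x+yi)=\max(|x|,|y|)$, $m(x+yi)=\min(|x|,|y|)$. For $z\ne0$, $u_z$ is the unique unit with $\Re(u_z z)=\ell_\infty(z)$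 if $\ell_\infty(z)\ne m(z)$, and the unique unit with $u_z z=\ell_\infty(z)(1+i)$ if $\ell_\infty(z)=m(z)$. $s(r)=\mathrm{sgn}(\Im(u_r r))\in\{ -1,0,1\}$. -}

module Defs where

open import Data.Nat as ℕ using (ℕ; zero; suc; _⊔_; _⊓_)
open import Data.Integer as ℤ using (ℤ; +_; -_; _+_; _-_; _*_; ∣_∣; _<_; _≤_; +0; 1ℤ; -1ℤ; sign)
open import Data.Integer.DivMod using (_/ℕ_; _%ℕ_)
open import Data.Bool using (if_then_else_)
open import Data.Vec using (Vec; []; _∷_; last)
open import Data.Product using (Σ; _×_)
open import Relation.Binary.PropositionalEquality using (_≡_; _≢_)
open import Relation.Nullary using (¬_)
open import Relation.Nullary.Decidable using (⌊_⌋)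

record GI : Set where
  constructor _+i_
  field
    re : ℤ
    im : ℤ
open GI public

0G : GI
0G = +0 +i +0

infixl 6 _⊕_ _⊖_
infixl 7 _⊗_

_⊕_ : GI → GI → GI
(a +i b) ⊕ (c +i d) = (a + c) +i (b + d)

_⊖_ : GI → GI → GI
(a +i b) ⊖ (c +i d) = (a - c) +i (b - d)

_⊗_ : GI → GI → GI
(a +i b) ⊗ (c +i d) = (a * c - b * d) +i (a * d + b * c)

conj : GI → GI
conj (a +i b) = a +i (- b)

Nm : GI → ℕ
Nm (x +i y) = ∣ x ∣ ℕ.* ∣ x ∣ ℕ.+ ∣ y ∣ ℕ.* ∣ y ∣

data Unit : Set where
  u1 u-1 ui u-i : Unit

unitVal : Unit → GI
unitVal u1  = 1ℤ +i +0
unitVal u-1 = -1ℤ +i +0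
unitVal ui  = +0 +i 1ℤ
unitVal u-i = +0 +i -1ℤ

data Digit : Set where
  d0 : Digit
  du : Unit → Digit

digitVal : Digit → GI
digitVal d0     = 0G
digitVal (du u) = unitVal u

1+i : GI
1+i = 1ℤ +i 1ℤ

evalDigits : ∀ {n} → Vec Digit n → GI
evalDigits []       = 0G
evalDigits (d ∷ ds) = digitVal d ⊕ 1+i ⊗ evalDigits ds

Rep : GI → ℕ → Set
Rep z n = Σ (Vec Digit (suc n)) λ ds → (last ds ≢ d0) × (evalDigits ds ≡ z)

IsPhi : GI → ℕ → Set
IsPhi z n = Rep z n × (∀ m → Rep z m → n ℕ.≤ m)

roundDiv : ℤ → ℕ → ℤ
roundDiv p zero    = +0   -- unused (N = 0 only when b = 0)
roundDiv p (suc k) =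
  if ⌊ 2 ℕ.* (p %ℕ suc k) ℕ.≤? suc k ⌋
  then p /ℕ suc k
  else p /ℕ suc k + 1ℤ

gaussQuot : GI → GI → GI
gaussQuot a b = let w = a ⊗ conj b ; N = Nm b in
  roundDiv (re w) N +i roundDiv (im w) N

gaussRem : GI → GI → GI
gaussRem a b = a ⊖ gaussQuot a b ⊗ b

ℓ∞ : GI → ℤ
ℓ∞ (x +i y) = + (∣ x ∣ ⊔ ∣ y ∣)

mm : GI → ℤ
mm (x +i y) = + (∣ x ∣ ⊓ ∣ y ∣)

IsUz : GI → Unit → Set
IsUz z u =
  (ℓ∞ z ≢ mm z → re (unitVal u ⊗ z) ≡ ℓ∞ z) ×
  (ℓ∞ z ≡ mm z → unitVal u ⊗ z ≡ (ℓ∞ z +i +0) ⊗ 1+i)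

sgn : ℤ → ℤ
sgn (+ zero)  = +0
sgn (+ suc _) = 1ℤ
sgn ℤ.-[1+ _ ] = -1ℤ

iG : GI
iG = +0 +i 1ℤ

ι : ℤ → GI
ι k = k +i +0

{-# OPTIONS --safe #-}
module Submission where

-- The unit u_z puts z in the normal form u_z z = ℓ∞(z) + ε m(z) i with ε = ±1,
-- since multiplying by a unit only permutes the coordinates up to sign.  The
-- hypothesis Im(u_b b) Im(u_r r) < 0 says that ε_b = -ε_r = -s(r), so the
-- imaginary parts of u_b b and -u_r r have the same sign and add in absolute
-- value, while s(r) i u_r r = -m(r) + s(r) ℓ∞(r) i.  Both identities then
-- follow by arithmetic; nothing about a, φ or the Gauss remainder is needed.

open import Defs
open import Algebra.Definitions using (Commutative)
open import Data.Nat using (ℕ; _≤_; _⊔_; _⊓_)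
import Data.Nat.Properties as ℕ
open import Data.Integer
  using (ℤ; _-_; _+_; _*_; -_; +0; _<_; +_; ∣_∣; 1ℤ; +[1+_]; -[1+_]; +<+; _≟_)
import Data.Integer.Properties as ℤ
open import Data.Integer.Tactic.RingSolver using (solve; solve-∀)
open import Data.List using (_∷_; [])
open import Data.Sum using (_⊎_; inj₁; inj₂)
open import Data.Product using (_×_; _,_)
open import Data.Empty using (⊥-elim)
open import Relation.Binary.PropositionalEquality
open import Relation.Nullary using (yes; no)

infix 4 _≡±_

_≡±_ : ℤ → ℤ → Set
x ≡± y = x ≡ y ⊎ x ≡ - y

u1-⊗ : ∀ x y → unitVal u1 ⊗ (x +i y) ≡ x +i y
u1-⊗ x y = cong₂ _+i_ (solve (x ∷ y ∷ [])) (solve (x ∷ y ∷ []))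

u-1-⊗ : ∀ x y → unitVal u-1 ⊗ (x +i y) ≡ (- x) +i (- y)
u-1-⊗ x y = cong₂ _+i_ (solve (x ∷ y ∷ [])) (solve (x ∷ y ∷ []))

ui-⊗ : ∀ x y → unitVal ui ⊗ (x +i y) ≡ (- y) +i x
ui-⊗ x y = cong₂ _+i_ (solve (x ∷ y ∷ [])) (solve (x ∷ y ∷ []))

u-i-⊗ : ∀ x y → unitVal u-i ⊗ (x +i y) ≡ y +i (- x)
u-i-⊗ x y = cong₂ _+i_ (solve (x ∷ y ∷ [])) (solve (x ∷ y ∷ []))

onAbsCoords : (ℕ → ℕ → ℕ) → GI → ℕ
onAbsCoords f (x +i y) = f (∣ x ∣) (∣ y ∣)

onAbsCoords-unit-⊗ : (f : ℕ → ℕ → ℕ) → Commutative _≡_ f →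
  ∀ u z → onAbsCoords f (unitVal u ⊗ z) ≡ onAbsCoords f z
onAbsCoords-unit-⊗ f comm u1 (x +i y) = cong (onAbsCoords f) (u1-⊗ x y)
onAbsCoords-unit-⊗ f comm u-1 (x +i y) =
  trans (cong (onAbsCoords f) (u-1-⊗ x y)) (cong₂ f (ℤ.∣-i∣≡∣i∣ x) (ℤ.∣-i∣≡∣i∣ y))
onAbsCoords-unit-⊗ f comm ui (x +i y) = begin
  onAbsCoords f (unitVal ui ⊗ (x +i y)) ≡⟨ cong (onAbsCoords f) (ui-⊗ x y) ⟩
  f (∣ - y ∣) (∣ x ∣)                    ≡⟨ cong (λ n → f n (∣ x ∣)) (ℤ.∣-i∣≡∣i∣ y) ⟩
  f (∣ y ∣) (∣ x ∣)                      ≡⟨ comm (∣ y ∣) (∣ x ∣) ⟩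
  f (∣ x ∣) (∣ y ∣)                      ∎
  where open ≡-Reasoning
onAbsCoords-unit-⊗ f comm u-i (x +i y) = begin
  onAbsCoords f (unitVal u-i ⊗ (x +i y)) ≡⟨ cong (onAbsCoords f) (u-i-⊗ x y) ⟩
  f (∣ y ∣) (∣ - x ∣)                     ≡⟨ cong (f (∣ y ∣)) (ℤ.∣-i∣≡∣i∣ x) ⟩
  f (∣ y ∣) (∣ x ∣)                       ≡⟨ comm (∣ y ∣) (∣ x ∣) ⟩
  f (∣ x ∣) (∣ y ∣)                       ∎
  where open ≡-Reasoning

ℓ∞-unit-⊗ : ∀ u z → ℓ∞ (unitVal u ⊗ z) ≡ ℓ∞ z
ℓ∞-unit-⊗ u (x +i y) = cong +_ (onAbsCoords-unit-⊗ _⊔_ ℕ.⊔-comm u (x +i y))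

mm-unit-⊗ : ∀ u z → mm (unitVal u ⊗ z) ≡ mm z
mm-unit-⊗ u (x +i y) = cong +_ (onAbsCoords-unit-⊗ _⊓_ ℕ.⊓-comm u (x +i y))

re-ι-⊗-1+i : ∀ k → re (ι k ⊗ 1+i) ≡ k
re-ι-⊗-1+i k = trans (ℤ.+-identityʳ (k * 1ℤ)) (ℤ.*-identityʳ k)

re-unit-⊗ : ∀ z u → IsUz z u → re (unitVal u ⊗ z) ≡ ℓ∞ z
re-unit-⊗ z u (off-diagonal , diagonal) with ℓ∞ z ≟ mm z
... | no ℓ∞≢mm = off-diagonal ℓ∞≢mm
... | yes ℓ∞≡mm = trans (cong re (diagonal ℓ∞≡mm)) (re-ι-⊗-1+i (ℓ∞ z))

re≡ℓ∞⇒∣im∣≡mm : ∀ w → re w ≡ ℓ∞ w → + ∣ im w ∣ ≡ mm w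
re≡ℓ∞⇒∣im∣≡mm w re≡ℓ∞ =
  cong +_ (sym (ℕ.m≥n⇒m⊓n≡n (ℕ.m⊔n≡m⇒n≤m (sym (cong ∣_∣ re≡ℓ∞)))))

unit-normal-form : ∀ z u → IsUz z u →
  re (unitVal u ⊗ z) ≡ ℓ∞ z × + ∣ im (unitVal u ⊗ z) ∣ ≡ mm z
unit-normal-form z u uz = re≡ , (begin
  + ∣ im (unitVal u ⊗ z) ∣ ≡⟨ re≡ℓ∞⇒∣im∣≡mm (unitVal u ⊗ z) (trans re≡ (sym (ℓ∞-unit-⊗ u z))) ⟩
  mm (unitVal u ⊗ z)      ≡⟨ mm-unit-⊗ u z ⟩
  mm z                    ∎)
  where
  open ≡-Reasoning
  re≡ : re (unitVal u ⊗ z) ≡ ℓ∞ z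
  re≡ = re-unit-⊗ z u uz

⊗-assoc : ∀ u v w → u ⊗ v ⊗ w ≡ u ⊗ (v ⊗ w)
⊗-assoc (a +i b) (c +i d) (e +i f) = cong₂ _+i_ (re-assoc a b c d e f) (im-assoc a b c d e f)
  where
  re-assoc : ∀ a b c d e f →
    (a * c - b * d) * e - (a * d + b * c) * f ≡ a * (c * e - d * f) - b * (c * f + d * e)
  re-assoc = solve-∀
  im-assoc : ∀ a b c d e f →
    (a * c - b * d) * f + (a * d + b * c) * e ≡ a * (c * f + d * e) + b * (c * e - d * f)
  im-assoc = solve-∀

ι-⊗-i-⊗ : ∀ s w → ι s ⊗ iG ⊗ w ≡ (- (s * im w)) +i (s * re w)
ι-⊗-i-⊗ s (x +i y) = cong₂ _+i_ (re-rotate s x y) (im-rotate s x y)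
  where
  re-rotate : ∀ s x y → (s * +0 - +0 * 1ℤ) * x - (s * 1ℤ + +0 * +0) * y ≡ - (s * y)
  re-rotate = solve-∀
  im-rotate : ∀ s x y → (s * +0 - +0 * 1ℤ) * y + (s * 1ℤ + +0 * +0) * x ≡ s * x
  im-rotate = solve-∀

sgn*≡∣∣ : ∀ q → sgn q * q ≡ + ∣ q ∣
sgn*≡∣∣ (+ 0)    = refl
sgn*≡∣∣ +[1+ n ] = ℤ.*-identityˡ +[1+ n ]
sgn*≡∣∣ -[1+ n ] = ℤ.-1*i≡-i -[1+ n ]

data OppositeSigns : ℤ → ℤ → Set where
  pos-neg : ∀ m n → OppositeSigns +[1+ m ] -[1+ n ]
  neg-pos : ∀ m n → OppositeSigns -[1+ m ] +[1+ n ]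

*<0⇒opposite-signs : ∀ p q → p * q < +0 → OppositeSigns p q
*<0⇒opposite-signs (+ 0)    q        (+<+ ())
*<0⇒opposite-signs p        (+ 0)    pq<0 = ⊥-elim (ℤ.<-irrefl (ℤ.*-zeroʳ p) pq<0)
*<0⇒opposite-signs +[1+ m ] +[1+ n ] (+<+ ())
*<0⇒opposite-signs +[1+ m ] -[1+ n ] _    = pos-neg m n
*<0⇒opposite-signs -[1+ m ] +[1+ n ] _    = neg-pos m n
*<0⇒opposite-signs -[1+ m ] -[1+ n ] (+<+ ())

opposite-signs⇒- : ∀ {p q} → OppositeSigns p q → p - q ≡± + ∣ p ∣ + + ∣ q ∣
opposite-signs⇒- (pos-neg m n) = inj₁ refl
opposite-signs⇒- (neg-pos m n) = inj₂ (sym (ℤ.neg-distrib-+ +[1+ m ] +[1+ n ]))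

opposite-signs⇒+sgn* : ∀ {p q} → OppositeSigns p q → ∀ k → p + sgn q * k ≡± + ∣ p ∣ - k
opposite-signs⇒+sgn* (pos-neg m n) k = inj₁ (cong (_+_ +[1+ m ]) (ℤ.-1*i≡-i k))
opposite-signs⇒+sgn* (neg-pos m n) k = inj₂ (begin
  -[1+ m ] + 1ℤ * k    ≡⟨ cong (_+_ -[1+ m ]) (ℤ.*-identityˡ k) ⟩
  - +[1+ m ] + k       ≡⟨ cong (_+_ (- +[1+ m ])) (ℤ.neg-involutive k) ⟨
  - +[1+ m ] + - - k   ≡⟨ ℤ.neg-distrib-+ +[1+ m ] (- k) ⟨
  - (+[1+ m ] - k)     ∎)
  where open ≡-Reasoning

⊖-normal-form : ∀ b r ub ur → IsUz b ub → IsUz r ur →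
  im (unitVal ub ⊗ b) * im (unitVal ur ⊗ r) < +0 →
  re (unitVal ub ⊗ b ⊖ unitVal ur ⊗ r) ≡ ℓ∞ b - ℓ∞ r ×
  im (unitVal ub ⊗ b ⊖ unitVal ur ⊗ r) ≡± mm b + mm r
⊖-normal-form b r ub ur uz-b uz-r imB*imR<0
  with unit-normal-form b ub uz-b | unit-normal-form r ur uz-r
... | reB , ∣imB∣ | reR , ∣imR∣ =
  cong₂ _-_ reB reR ,
  subst (im B - im R ≡±_) (cong₂ _+_ ∣imB∣ ∣imR∣)
        (opposite-signs⇒- (*<0⇒opposite-signs (im B) (im R) imB*imR<0))
  where
  B = unitVal ub ⊗ b
  R = unitVal ur ⊗ r

rotated-⊕-normal-form : ∀ b r ub ur → IsUz b ub → IsUz r ur →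
  im (unitVal ub ⊗ b) * im (unitVal ur ⊗ r) < +0 →
  let W = unitVal ub ⊗ b ⊕ ι (sgn (im (unitVal ur ⊗ r))) ⊗ iG ⊗ unitVal ur ⊗ r in
  re W ≡ ℓ∞ b - mm r × im W ≡± mm b - ℓ∞ r
rotated-⊕-normal-form b r ub ur uz-b uz-r imB*imR<0
  with unit-normal-form b ub uz-b | unit-normal-form r ur uz-r
... | reB , ∣imB∣ | reR , ∣imR∣ =
  cong₂ _+_ reB (trans (cong re rotated) (cong -_ (trans (sgn*≡∣∣ (im R)) ∣imR∣))) ,
  subst₂ _≡±_ (cong (_+_ (im B)) (sym (cong im rotated))) (cong₂ _-_ ∣imB∣ reR)
         (opposite-signs⇒+sgn* (*<0⇒opposite-signs (im B) (im R) imB*imR<0) (re R))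
  where
  B = unitVal ub ⊗ b
  R = unitVal ur ⊗ r
  s = sgn (im R)
  rotated : ι s ⊗ iG ⊗ unitVal ur ⊗ r ≡ (- (s * im R)) +i (s * re R)
  rotated = trans (⊗-assoc (ι s ⊗ iG) (unitVal ur) r) (ι-⊗-i-⊗ s R)

lemma7 : (a b : GI) → a ≢ 0G → b ≢ 0G → gaussRem a b ≢ 0G →
    (n k : ℕ) → IsPhi b n → IsPhi (gaussRem a b) k → n ≤ k →
    (ub ur : Unit) → IsUz b ub → IsUz (gaussRem a b) ur →
    im (unitVal ub ⊗ b) * im (unitVal ur ⊗ gaussRem a b) < +0 →
    (re (unitVal ub ⊗ b ⊖ unitVal ur ⊗ gaussRem a b) ≡ ℓ∞ b - ℓ∞ (gaussRem a b)
      × (im (unitVal ub ⊗ b ⊖ unitVal ur ⊗ gaussRem a b) ≡ mm b + mm (gaussRem a b)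
        ⊎ im (unitVal ub ⊗ b ⊖ unitVal ur ⊗ gaussRem a b) ≡ - (mm b + mm (gaussRem a b))))
    × (re (unitVal ub ⊗ b ⊕ ι (sgn (im (unitVal ur ⊗ gaussRem a b))) ⊗ iG ⊗ unitVal ur ⊗ gaussRem a b)
         ≡ ℓ∞ b - mm (gaussRem a b)
      × (im (unitVal ub ⊗ b ⊕ ι (sgn (im (unitVal ur ⊗ gaussRem a b))) ⊗ iG ⊗ unitVal ur ⊗ gaussRem a b)
           ≡ mm b - ℓ∞ (gaussRem a b)
        ⊎ im (unitVal ub ⊗ b ⊕ ι (sgn (im (unitVal ur ⊗ gaussRem a b))) ⊗ iG ⊗ unitVal ur ⊗ gaussRem a b)
           ≡ - (mm b - ℓ∞ (gaussRem a b))))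
lemma7 a b _ _ _ _ _ _ _ _ ub ur uz-b uz-r opposite =
  ⊖-normal-form b r ub ur uz-b uz-r opposite ,
  rotated-⊕-normal-form b r ub ur uz-b uz-r opposite
  where r = gaussRem a b
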